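{- Let $n\ge 0$, $r\ge 1$, $p\ge 1$ be integers with $r^{p-1}\le\binom{n+p-1}{p-1}$, and let $S$ be a set with $n$ elements. Let $M_1\ge M_2\ge\cdots\ge M_{N}$, $N=\binom{n+p-1}{p-1}$, be the $p$-multinomial coefficients for $n$ in non-increasing order, and set $M_{N+1}:=0$. Suppose $(A_{j1},\dots,A_{jp})$, $j=1,\dots,m$, are $m$ distinct weak compositions of $S$ into $p$ parts such that for each $k\in[p-1]$ the set $\{A_{jk}:1\le j\le m\}$ is $r$-chain-free, and suppose $m=M_1+\dots+M_{r^{p-1}}$. Then the family contains every weak composition of $S$ into $p$ parts whose shape $(a_1,\dots,a_p)$ satisfies $\binom{n}{a_1,\dots,a_p}>M_{r^{p-1}+1}$, and contains no weak composition whose shape satisfies $\binom{n}{a_1,\dots,a_p}<M_{r^{p-1}}$.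
   Context: A weak composition of $S$ into $p$ parts is an ordered $p$-tuple $(A_1,\dots,A_p)$ of pairwise disjoint, possibly empty, subsets of $S$ with $A_1\cup\dots\cup A_p=S$; its shape is $(|A_1|,\dots,|A_p|)$. A family of subsets of $S$ is $r$-chain-free if every chain (set totally ordered by inclusion) in it has at most $r$ elements. $[p-1]=\{1,\dots,p-1\}$. The $p$-multinomial coefficients for $n$ are the numbers $\binom{n}{a_1,\dots,a_p}=\frac{n!}{a_1!\cdots a_p!}$, one for each ordered tuple (shape) $(a_1,\dots,a_p)$ of nonnegative integers summing to $n$. -}

module Defs where

open import Data.Nat using (ℕ; zero; suc; _+_; _*_; _∸_; _/_; NonZero)
open import Data.Nat.Properties using (≤-decTotalOrder; _!≢0; m*n≢0)
open import Relation.Binary.Properties.DecTotalOrder ≤-decTotalOrder using (≥-decTotalOrder)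
open import Data.Nat.Base using (_!)
open import Data.Fin using (Fin)
open import Data.Fin.Subset using (Subset; _∈_; _⊆_; ∣_∣)
open import Data.Vec using (Vec; []; _∷_; tabulate)
open import Data.List using (List; []; _∷_; map; concatMap; upTo; take; lookup)
open import Data.Nat.ListAction using (sum)
import Data.List as L
open import Data.Product using (Σ; ∃; _×_; _,_)
open import Data.Sum using (_⊎_)
open import Relation.Binary.PropositionalEquality using (_≡_; _≢_)
import Data.List.Sort.InsertionSort as Sort

record WeakComposition (n p : ℕ) : Set where
  field
    part     : Fin p → Subset n
    disjoint : ∀ k l (x : Fin n) → x ∈ part k → x ∈ part l → k ≡ l
    covers   : ∀ (x : Fin n) → ∃ λ k → x ∈ part k
open WeakComposition public

shape : ∀ {n p} → WeakComposition n p → Vec ℕ p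
shape W = tabulate λ k → ∣ part W k ∣

prodFact : ∀ {p} → Vec ℕ p → ℕ
prodFact [] = 1
prodFact (a ∷ as) = a ! * prodFact as

prodFact≢0 : ∀ {p} (as : Vec ℕ p) → NonZero (prodFact as)
prodFact≢0 [] = _
prodFact≢0 (a ∷ as) = m*n≢0 (a !) (prodFact as) {{a !≢0}} {{prodFact≢0 as}}

multinomial : ∀ {p} → ℕ → Vec ℕ p → ℕ
multinomial n as = (n ! / prodFact as) {{prodFact≢0 as}}

shapes : (p n : ℕ) → List (Vec ℕ p)
shapes zero zero = [] ∷ []
shapes zero (suc n) = []
shapes (suc p) n = concatMap (λ a → map (a ∷_) (shapes p (n ∸ a))) (upTo (suc n))

sortedMultinomials : (n p : ℕ) → List ℕ
sortedMultinomials n p = Sort.sort ≥-decTotalOrder (map (multinomial n) (shapes p n))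

-- M i (1-indexed): i-th largest p-multinomial coefficient; 0 if i = 0 or i > N
-- (in particular M (N+1) = 0)
lookupDefault : List ℕ → ℕ → ℕ
lookupDefault [] i = 0
lookupDefault (x ∷ xs) zero = x
lookupDefault (x ∷ xs) (suc i) = lookupDefault xs i

M : (n p : ℕ) → ℕ → ℕ
M n p zero = 0
M n p (suc i) = lookupDefault (sortedMultinomials n p) i

sumTopM : (n p t : ℕ) → ℕ
sumTopM n p t = sum (take t (sortedMultinomials n p))

Distinct : ∀ {n p m} → (Fin m → WeakComposition n p) → Set
Distinct {m = m} F = ∀ (i j : Fin m) → i ≢ j → ∃ λ k → part (F i) k ≢ part (F j) k

IsChain : ∀ {n m t} → (Fin m → Subset n) → (Fin t → Fin m) → Set
IsChain {t = t} A c =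
  (∀ (a b : Fin t) → a ≢ b → A (c a) ≢ A (c b)) ×
  (∀ (a b : Fin t) → (A (c a) ⊆ A (c b)) ⊎ (A (c b) ⊆ A (c a)))

ChainFree : ∀ {n m} → ℕ → (Fin m → Subset n) → Set
ChainFree {m = m} r A = ∀ (t : ℕ) (c : Fin t → Fin m) → IsChain A c → t Data.Nat.≤ r

Contains : ∀ {n p m} → (Fin m → WeakComposition n p) → WeakComposition n p → Set
Contains F W = ∃ λ j → ∀ k → part (F j) k ≡ part W k

{-# OPTIONS --safe #-}
module Submission where

-- The LYM permutation method.  Call a permutation σ of S compatible with a
-- composition (A₁,…,A_p) if σ lists A₁ first, then A₂, and so on; a composition
-- of shape a is compatible with ∏ aₖ! permutations.  For fixed σ, the compatible
-- members of the family have distinct shapes, and those agreeing on A₁,…,A_{k-1}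
-- have comparable k-th parts, which therefore form a chain; so at most
-- t = r^{p-1} members are compatible with σ, and their multinomials sum to at
-- most T = M₁ + … + M_t.  Summing over σ counts each member of shape a exactly
-- ∏ aₖ! times with weight n!/∏ aₖ!, whence m·n! ≤ n!·T.  Since m = T every σ
-- attains the bound, and a composition violating either conclusion yields a σ
-- where it is strict.

open import Data.Bool using (true; false; if_then_else_)
import Data.Bool.Properties as Bool
open import Data.Empty using (⊥; ⊥-elim)
open import Data.Fin as Fin using (Fin; zero; suc; toℕ; inject₁; fromℕ)
import Data.Fin.Properties as Finₚ
open import Data.Fin.Subset using (Subset; inside; outside; ∣_∣)
  renaming (_∈_ to _∈ₛ_; _∉_ to _∉ₛ_; _⊆_ to _⊆ₛ_)
open import Data.Fin.Subset.Properties using (_∈?_; drop-there; ⊆-antisym)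
open import Data.List as List
  using (List; []; _∷_; _++_; map; length; filter; concatMap; downFrom; take; allFin)
open import Data.List.Properties
  using (map-++; length-map; map-tabulate; length-tabulate; length-removeAt′; filter-none; filter-notAll; length-filter)
open import Data.List.Membership.Propositional using (_∈_; find)
open import Data.List.Membership.Propositional.Properties
  using ( ∈-allFin; ∈-lookup; ∈-filter⁻; ∈-filter⁺; ∈-downFrom⁺; ∈-AllPairs₂; ∈-map⁺; ∈-map⁻
        ; ∈-concatMap⁺; ∈-concatMap⁻; ∈-upTo⁺)
open import Data.List.Relation.Unary.All using (All; []; _∷_)
import Data.List.Relation.Unary.All as All
import Data.List.Relation.Unary.All.Properties as All
open import Data.List.Relation.Unary.AllPairs using (AllPairs; []; _∷_; allPairs?)
import Data.List.Relation.Unary.AllPairs as AllPairs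
open import Data.List.Relation.Unary.Any using (here; there; _─_; index)
import Data.List.Relation.Unary.Any as Any
open import Data.List.Relation.Unary.Linked.Properties using (Linked⇒AllPairs)
open import Data.List.Relation.Unary.Unique.Propositional using (Unique)
import Data.List.Relation.Unary.Unique.Propositional.Properties as Unique
open import Data.List.Relation.Binary.Permutation.Propositional using (_↭_; ↭-refl; ↭-sym; ↭-trans; prep; swap)
import Data.List.Relation.Binary.Permutation.Propositional.Properties as ↭
import Data.List.Sort.InsertionSort.Properties as InsertionSort
open import Data.Nat
open import Data.Nat.Combinatorics using (_C_; k![n∸k]!∣n!)
open import Data.Nat.Divisibility using (_∣_; ∣-refl; ∣-trans; *-monoʳ-∣)
open import Data.Nat.DivMod using (m/n*n≡m; m/n≤m)
open import Data.Nat.ListAction using (sum)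
open import Data.Nat.ListAction.Properties using (sum-++; sum-↭)
open import Data.Nat.Properties
open import Algebra.Properties.CommutativeSemigroup +-commutativeSemigroup using (interchange)
open import Algebra.Properties.CommutativeSemigroup *-commutativeSemigroup using (x∙yz≈y∙xz)
open import Data.Product using (∃; _×_; _,_; proj₁; proj₂)
open import Data.Sum using (_⊎_; inj₁; inj₂)
open import Data.Vec using (Vec; tabulate) renaming ([] to []ᵥ; _∷_ to _∷ᵥ_)
import Data.Vec as Vec
open import Data.Vec.Properties using (tabulate-cong; lookup∘tabulate; ≡-dec)
open import Function using (id; _∘_; case_of_)
open import Relation.Binary using (Tri; tri<; tri≈; tri>; DecidableEquality)
open import Relation.Binary.Properties.DecTotalOrder ≤-decTotalOrder using (≥-decTotalOrder)
open import Relation.Binary.PropositionalEquality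
open import Relation.Nullary using (Dec; yes; no; does; ¬_; ¬?)
open import Relation.Nullary.Decidable using (decidable-stable; _×-dec_)
open import Relation.Unary using (Decidable)

open import Defs

private variable
  A B : Set

∑ : List A → (A → ℕ) → ℕ
∑ xs f = sum (map f xs)

syntax ∑ xs (λ x → e) = ∑[ x ∈ xs ] e

module _ {f g : A → ℕ} where

  ∑-cong : ∀ xs → (∀ {x} → x ∈ xs → f x ≡ g x) → ∑ xs f ≡ ∑ xs g
  ∑-cong []       _   = refl
  ∑-cong (x ∷ xs) f≡g = cong₂ _+_ (f≡g (here refl)) (∑-cong xs (f≡g ∘ there))

  ∑-mono-≤ : ∀ xs → (∀ {x} → x ∈ xs → f x ≤ g x) → ∑ xs f ≤ ∑ xs g
  ∑-mono-≤ []       _   = z≤n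
  ∑-mono-≤ (x ∷ xs) f≤g = +-mono-≤ (f≤g (here refl)) (∑-mono-≤ xs (f≤g ∘ there))

  ∑-mono-< : ∀ xs → (∀ {x} → x ∈ xs → f x ≤ g x) → ∀ {y} → y ∈ xs → f y < g y → ∑ xs f < ∑ xs g
  ∑-mono-< (x ∷ xs) f≤g (here refl) fy<gy = +-mono-<-≤ fy<gy (∑-mono-≤ xs (f≤g ∘ there))
  ∑-mono-< (x ∷ xs) f≤g (there y∈) fy<gy = +-mono-≤-< (f≤g (here refl)) (∑-mono-< xs (f≤g ∘ there) y∈ fy<gy)

  ∑-distrib-+ : ∀ xs → ∑[ x ∈ xs ] (f x + g x) ≡ ∑ xs f + ∑ xs g
  ∑-distrib-+ []       = refl
  ∑-distrib-+ (x ∷ xs) rewrite ∑-distrib-+ xs = interchange (f x) (g x) (∑ xs f) (∑ xs g)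

∑-const : ∀ (xs : List A) c → ∑[ x ∈ xs ] c ≡ length xs * c
∑-const []       c = refl
∑-const (x ∷ xs) c = cong (c +_) (∑-const xs c)

∑-0 : ∀ (xs : List A) → ∑[ x ∈ xs ] 0 ≡ 0
∑-0 xs = trans (∑-const xs 0) (*-zeroʳ (length xs))

∑-*ʳ : ∀ (xs : List A) (f : A → ℕ) c → ∑[ x ∈ xs ] (f x * c) ≡ ∑ xs f * c
∑-*ʳ []       f c = refl
∑-*ʳ (x ∷ xs) f c = trans (cong (f x * c +_) (∑-*ʳ xs f c)) (sym (*-distribʳ-+ c (f x) (∑ xs f)))

∑-comm : ∀ (xs : List A) (ys : List B) (g : A → B → ℕ) →
         ∑[ x ∈ xs ] ∑[ y ∈ ys ] g x y ≡ ∑[ y ∈ ys ] ∑[ x ∈ xs ] g x y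
∑-comm []       ys g = sym (∑-0 ys)
∑-comm (x ∷ xs) ys g = trans (cong (∑ ys (g x) +_) (∑-comm xs ys g)) (sym (∑-distrib-+ ys))

∑-↭ : ∀ {xs ys : List A} (f : A → ℕ) → xs ↭ ys → ∑ xs f ≡ ∑ ys f
∑-↭ f xs↭ys = sum-↭ (↭.map⁺ f xs↭ys)

∑-concatMap : ∀ (xs : List A) (g : A → List B) (f : B → ℕ) →
              ∑ (concatMap g xs) f ≡ ∑[ x ∈ xs ] ∑ (g x) f
∑-concatMap []       g f = refl
∑-concatMap (x ∷ xs) g f = begin
  sum (map f (g x ++ concatMap g xs))            ≡⟨ cong sum (map-++ f (g x) _) ⟩
  sum (map f (g x) ++ map f (concatMap g xs))    ≡⟨ sum-++ (map f (g x)) _ ⟩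
  ∑ (g x) f + ∑ (concatMap g xs) f               ≡⟨ cong (∑ (g x) f +_) (∑-concatMap xs g f) ⟩
  ∑ (g x) f + ∑[ x ∈ xs ] ∑ (g x) f              ∎
  where open ≡-Reasoning

length≡∑1 : ∀ (xs : List A) → length xs ≡ ∑[ x ∈ xs ] 1
length≡∑1 xs = sym (trans (∑-const xs 1) (*-identityʳ (length xs)))

length-allFin : ∀ k → length (allFin k) ≡ k
length-allFin k = length-tabulate {n = k} id

𝟙 : {P : Set} → Dec P → ℕ
𝟙 P? = if does P? then 1 else 0

module _ {P : Set} where

  𝟙-yes : P → (P? : Dec P) → 𝟙 P? ≡ 1
  𝟙-yes p (yes _) = refl
  𝟙-yes p (no ¬p) = ⊥-elim (¬p p)

  𝟙-no : ¬ P → (P? : Dec P) → 𝟙 P? ≡ 0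
  𝟙-no ¬p (yes p) = ⊥-elim (¬p p)
  𝟙-no ¬p (no _)  = refl

𝟙≤1 : {P : Set} (P? : Dec P) → 𝟙 P? ≤ 1
𝟙≤1 (yes _) = ≤-refl
𝟙≤1 (no _)  = z≤n

𝟙+𝟙¬ : {P : Set} (P? : Dec P) → 𝟙 P? + 𝟙 (¬? P?) ≡ 1
𝟙+𝟙¬ (yes _) = refl
𝟙+𝟙¬ (no _)  = refl

𝟙-cong : {P Q : Set} → (P → Q) → (Q → P) → (P? : Dec P) (Q? : Dec Q) → 𝟙 P? ≡ 𝟙 Q?
𝟙-cong P⇒Q Q⇒P (yes p) Q? = sym (𝟙-yes (P⇒Q p) Q?)
𝟙-cong P⇒Q Q⇒P (no ¬p) Q? = sym (𝟙-no (¬p ∘ Q⇒P) Q?)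

module _ {P : A → Set} (P? : Decidable P) where

  count : List A → ℕ
  count xs = length (filter P? xs)

  count-∷ : ∀ x xs → count (x ∷ xs) ≡ 𝟙 (P? x) + count xs
  count-∷ x xs with does (P? x)
  ... | true  = refl
  ... | false = refl

  count≡∑𝟙 : ∀ xs → count xs ≡ ∑[ x ∈ xs ] 𝟙 (P? x)
  count≡∑𝟙 []       = refl
  count≡∑𝟙 (x ∷ xs) = trans (count-∷ x xs) (cong (𝟙 (P? x) +_) (count≡∑𝟙 xs))

  count-↭ : ∀ {xs ys} → xs ↭ ys → count xs ≡ count ys
  count-↭ {xs} {ys} xs↭ys = trans (count≡∑𝟙 xs) (trans (∑-↭ (𝟙 ∘ P?) xs↭ys) (sym (count≡∑𝟙 ys)))

  count≤length : ∀ xs → count xs ≤ length xs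
  count≤length = length-filter P?

  count<length : ∀ {x xs} → x ∈ xs → ¬ P x → count xs < length xs
  count<length x∈xs ¬px = filter-notAll P? _ (Any.map (λ { refl → ¬px }) x∈xs)

  count≡0 : ∀ {xs} → (∀ {x} → x ∈ xs → ¬ P x) → count xs ≡ 0
  count≡0 none = cong length (filter-none P? (All.tabulate none))

  count>0 : ∀ xs → 0 < count xs → ∃ λ x → x ∈ xs × P x
  count>0 xs pos with filter P? xs in eq
  ... | x ∷ _ = x , ∈-filter⁻ P? (subst (x ∈_) (sym eq) (here refl))

  ∑-𝟙* : ∀ xs c → ∑[ x ∈ xs ] (𝟙 (P? x) * c) ≡ count xs * c
  ∑-𝟙* xs c = trans (∑-*ʳ xs (𝟙 ∘ P?) c) (cong (_* c) (sym (count≡∑𝟙 xs)))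

count-cong : ∀ {P Q : A → Set} (P? : Decidable P) (Q? : Decidable Q) xs →
             (∀ {x} → x ∈ xs → P x → Q x) → (∀ {x} → x ∈ xs → Q x → P x) → count P? xs ≡ count Q? xs
count-cong P? Q? xs P⇒Q Q⇒P = begin
  count P? xs             ≡⟨ count≡∑𝟙 P? xs ⟩
  ∑[ x ∈ xs ] 𝟙 (P? x)    ≡⟨ ∑-cong xs (λ x∈ → 𝟙-cong (P⇒Q x∈) (Q⇒P x∈) (P? _) (Q? _)) ⟩
  ∑[ x ∈ xs ] 𝟙 (Q? x)    ≡⟨ count≡∑𝟙 Q? xs ⟨
  count Q? xs             ∎
  where open ≡-Reasoning

count-map : ∀ {P : B → Set} (P? : Decidable P) (g : A → B) xs → count P? (map g xs) ≡ count (P? ∘ g) xs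
count-map P? g []       = refl
count-map P? g (x ∷ xs) = trans (count-∷ P? (g x) (map g xs))
  (trans (cong (𝟙 (P? (g x)) +_) (count-map P? g xs)) (sym (count-∷ (P? ∘ g) x xs)))

count+count¬ : ∀ {P : A → Set} (P? : Decidable P) xs → count P? xs + count (¬? ∘ P?) xs ≡ length xs
count+count¬ P? []       = refl
count+count¬ P? (x ∷ xs) = begin
  count P? (x ∷ xs) + count (¬? ∘ P?) (x ∷ xs)
    ≡⟨ cong₂ _+_ (count-∷ P? x xs) (count-∷ (¬? ∘ P?) x xs) ⟩
  (𝟙 (P? x) + count P? xs) + (𝟙 (¬? (P? x)) + count (¬? ∘ P?) xs)
    ≡⟨ interchange (𝟙 (P? x)) (count P? xs) (𝟙 (¬? (P? x))) (count (¬? ∘ P?) xs) ⟩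
  (𝟙 (P? x) + 𝟙 (¬? (P? x))) + (count P? xs + count (¬? ∘ P?) xs)
    ≡⟨ cong₂ _+_ (𝟙+𝟙¬ (P? x)) (count+count¬ P? xs) ⟩
  suc (length xs)
    ∎
  where open ≡-Reasoning

count≤count-∷ : ∀ {P : A → Set} (P? : Decidable P) x xs → count P? xs ≤ count P? (x ∷ xs)
count≤count-∷ P? x xs = subst (count P? xs ≤_) (sym (count-∷ P? x xs)) (m≤n+m _ _)

count-filter≤ : ∀ {P Q : A → Set} (P? : Decidable P) (Q? : Decidable Q) xs → count P? (filter Q? xs) ≤ count P? xs
count-filter≤ P? Q? []       = z≤n
count-filter≤ P? Q? (x ∷ xs) with does (Q? x)
... | true  = subst₂ _≤_ (sym (count-∷ P? x (filter Q? xs))) (sym (count-∷ P? x xs))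
                (+-monoʳ-≤ (𝟙 (P? x)) (count-filter≤ P? Q? xs))
... | false = ≤-trans (count-filter≤ P? Q? xs) (count≤count-∷ P? x xs)

∑-filter : ∀ {P : A → Set} (P? : Decidable P) (f : A → ℕ) xs → ∑ (filter P? xs) f ≡ ∑[ x ∈ xs ] (𝟙 (P? x) * f x)
∑-filter P? f []       = refl
∑-filter P? f (x ∷ xs) with does (P? x)
... | true  = cong₂ _+_ (sym (+-identityʳ (f x))) (∑-filter P? f xs)
... | false = ∑-filter P? f xs

∈-─ : ∀ {x y : A} {ys} (x∈ys : x ∈ ys) → y ∈ ys → y ≢ x → y ∈ (ys ─ x∈ys)
∈-─ (here refl) (here refl) y≢x = ⊥-elim (y≢x refl)
∈-─ (here refl) (there y∈ys) _   = y∈ys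
∈-─ (there x∈ys) (here refl) _   = here refl
∈-─ (there x∈ys) (there y∈ys) y≢x = there (∈-─ x∈ys y∈ys y≢x)

Unique-⊆⇒length≤ : ∀ {xs ys : List A} → Unique xs → (∀ {x} → x ∈ xs → x ∈ ys) → length xs ≤ length ys
Unique-⊆⇒length≤ [] _ = z≤n
Unique-⊆⇒length≤ {xs = x ∷ xs} {ys} (x∉xs ∷ xs!) xs⊆ys = begin
  suc (length xs)          ≤⟨ s≤s (Unique-⊆⇒length≤ xs! λ y∈xs →
                                 ∈-─ x∈ys (xs⊆ys (there y∈xs)) (≢-sym (All.lookup x∉xs y∈xs))) ⟩
  suc (length (ys ─ x∈ys)) ≡⟨ length-removeAt′ ys (index x∈ys) ⟨
  length ys                ∎
  where
  open ≤-Reasoning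
  x∈ys : x ∈ ys
  x∈ys = xs⊆ys (here refl)

count-mono-Unique : ∀ {P : A → Set} (P? : Decidable P) {xs ys} → Unique xs →
                    (∀ {x} → x ∈ xs → P x → x ∈ ys) → count P? xs ≤ count P? ys
count-mono-Unique P? xs! P-xs⊆ys = Unique-⊆⇒length≤ (Unique.filter⁺ P? xs!) λ x∈ →
  let x∈xs , px = ∈-filter⁻ P? x∈ in ∈-filter⁺ P? (P-xs⊆ys x∈xs px) px

Unique-map⁺ : ∀ (f : A → B) {xs} → Unique xs → (∀ {x y} → x ∈ xs → y ∈ xs → f x ≡ f y → x ≡ y) →
              Unique (map f xs)
Unique-map⁺ f []            _   = []
Unique-map⁺ f (x∉xs ∷ xs!) inj =
  All.map⁺ (All.tabulate λ y∈ fx≡fy → All.lookup x∉xs y∈ (inj (here refl) (there y∈) fx≡fy))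
  ∷ Unique-map⁺ f xs! (λ x∈ y∈ → inj (there x∈) (there y∈))

AllPairs-lookup : ∀ {S : A → A → Set} → (∀ {a b} → S a b → S b a) → ∀ {xs} → AllPairs S xs →
                  ∀ {i j : Fin (length xs)} → i ≢ j → S (List.lookup xs i) (List.lookup xs j)
AllPairs-lookup S-sym (_ ∷ _)   {zero}  {zero}  i≢j = ⊥-elim (i≢j refl)
AllPairs-lookup S-sym (Sx ∷ _)  {zero}  {suc j} _   = All.lookup Sx (∈-lookup j)
AllPairs-lookup S-sym (Sx ∷ _)  {suc i} {zero}  _   = S-sym (All.lookup Sx (∈-lookup i))
AllPairs-lookup S-sym (_ ∷ Sxs) {suc i} {suc j} i≢j = AllPairs-lookup S-sym Sxs (i≢j ∘ cong suc)

-- Sums of the largest entries of a list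

count-<-downFrom : ∀ a V → count (_<? a) (downFrom V) ≡ a ⊓ V
count-<-downFrom a zero    = sym (⊓-zeroʳ a)
count-<-downFrom a (suc V) = begin
  count (_<? a) (downFrom (suc V))         ≡⟨ count-∷ (_<? a) V (downFrom V) ⟩
  𝟙 (V <? a) + count (_<? a) (downFrom V)  ≡⟨ cong (𝟙 (V <? a) +_) (count-<-downFrom a V) ⟩
  𝟙 (V <? a) + a ⊓ V                       ≡⟨ step (V <? a) ⟩
  a ⊓ suc V                                ∎
  where
  open ≡-Reasoning
  step : (V<?a : Dec (V < a)) → 𝟙 V<?a + a ⊓ V ≡ a ⊓ suc V
  step (yes V<a) = trans (cong suc (m≥n⇒m⊓n≡n (<⇒≤ V<a))) (sym (m≥n⇒m⊓n≡n V<a))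
  step (no  V≮a) = trans (m≤n⇒m⊓n≡m (≮⇒≥ V≮a)) (sym (m≤n⇒m⊓n≡m (m≤n⇒m≤1+n (≮⇒≥ V≮a))))

sum≡∑count : ∀ V xs → All (_≤ V) xs → sum xs ≡ ∑[ v ∈ downFrom V ] count (v <?_) xs
sum≡∑count V []       []            = sym (∑-0 (downFrom V))
sum≡∑count V (x ∷ xs) (x≤V ∷ xs≤V) = begin
  x + sum xs
    ≡⟨ cong₂ _+_ (sym (trans (count-<-downFrom x V) (m≤n⇒m⊓n≡m x≤V))) (sum≡∑count V xs xs≤V) ⟩
  count (_<? x) (downFrom V) + ∑[ v ∈ downFrom V ] count (v <?_) xs
    ≡⟨ cong (_+ _) (count≡∑𝟙 (_<? x) (downFrom V)) ⟩
  ∑[ v ∈ downFrom V ] 𝟙 (v <? x) + ∑[ v ∈ downFrom V ] count (v <?_) xs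
    ≡⟨ ∑-distrib-+ (downFrom V) ⟨
  ∑[ v ∈ downFrom V ] (𝟙 (v <? x) + count (v <?_) xs)
    ≡⟨ ∑-cong (downFrom V) (λ {v} _ → sym (count-∷ (v <?_) x xs)) ⟩
  ∑[ v ∈ downFrom V ] count (v <?_) (x ∷ xs)
    ∎
  where open ≡-Reasoning

Descending : List ℕ → Set
Descending = AllPairs _≥_

count<≡0 : ∀ {v x xs} → All (_≤ x) xs → x ≤ v → count (v <?_) xs ≡ 0
count<≡0 xs≤x x≤v = count≡0 (_ <?_) λ y∈xs v<y → <⇒≱ v<y (≤-trans (All.lookup xs≤x y∈xs) x≤v)

count-take : ∀ {v} t {xs} → Descending xs → count (v <?_) (take t xs) ≡ t ⊓ count (v <?_) xs
count-take zero    _                   = refl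
count-take (suc t) {[]}     _          = refl
count-take {v} (suc t) {x ∷ xs} (xs≤x ∷ desc) = begin
  count (v <?_) (x ∷ take t xs)             ≡⟨ count-∷ (v <?_) x (take t xs) ⟩
  𝟙 (v <? x) + count (v <?_) (take t xs)    ≡⟨ cong (𝟙 (v <? x) +_) (count-take t desc) ⟩
  𝟙 (v <? x) + t ⊓ count (v <?_) xs         ≡⟨ step (v <? x) ⟩
  suc t ⊓ (𝟙 (v <? x) + count (v <?_) xs)   ≡⟨ cong (suc t ⊓_) (count-∷ (v <?_) x xs) ⟨
  suc t ⊓ count (v <?_) (x ∷ xs)            ∎
  where
  open ≡-Reasoning
  step : (v<?x : Dec (v < x)) → 𝟙 v<?x + t ⊓ count (v <?_) xs ≡ suc t ⊓ (𝟙 v<?x + count (v <?_) xs)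
  step (yes _)   = refl
  step (no  v≮x) rewrite count<≡0 xs≤x (≮⇒≥ v≮x) = ⊓-zeroʳ t

sum-take≡∑⊓count : ∀ V t {xs} → Descending xs → All (_≤ V) xs →
                   sum (take t xs) ≡ ∑[ v ∈ downFrom V ] (t ⊓ count (v <?_) xs)
sum-take≡∑⊓count V t {xs} desc xs≤V = trans (sum≡∑count V (take t xs) (All.take⁺ t xs≤V))
  (∑-cong (downFrom V) λ _ → count-take t desc)

lookupDefault≤ : ∀ {b} xs i → All (_≤ b) xs → lookupDefault xs i ≤ b
lookupDefault≤ []       i       _          = z≤n
lookupDefault≤ (x ∷ xs) zero    (x≤b ∷ _)  = x≤b
lookupDefault≤ (x ∷ xs) (suc i) (_ ∷ xs≤b) = lookupDefault≤ xs i xs≤b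

<lookupDefault⇒<count : ∀ {v} t {xs} → Descending xs → v < lookupDefault xs t → t < count (v <?_) xs
<lookupDefault⇒<count {v} zero    {x ∷ xs} _             v<x = begin-strict
  0                          <⟨ z<s ⟩
  1                          ≡⟨ 𝟙-yes v<x (v <? x) ⟨
  𝟙 (v <? x)                 ≤⟨ m≤m+n _ _ ⟩
  𝟙 (v <? x) + count (v <?_) xs ≡⟨ count-∷ (v <?_) x xs ⟨
  count (v <?_) (x ∷ xs)     ∎
  where open ≤-Reasoning
<lookupDefault⇒<count {v} (suc t) {x ∷ xs} (xs≤x ∷ desc) v<ℓ = begin-strict
  suc t                     <⟨ s≤s (<lookupDefault⇒<count t desc v<ℓ) ⟩
  suc (count (v <?_) xs)    ≡⟨ cong (_+ count (v <?_) xs) (𝟙-yes (<-≤-trans v<ℓ (lookupDefault≤ xs t xs≤x)) (v <? x)) ⟨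
  𝟙 (v <? x) + count (v <?_) xs ≡⟨ count-∷ (v <?_) x xs ⟨
  count (v <?_) (x ∷ xs)    ∎
  where open ≤-Reasoning

lookupDefault≤⇒count≤ : ∀ {v} t {xs} → Descending xs → lookupDefault xs t ≤ v → count (v <?_) xs ≤ t
lookupDefault≤⇒count≤ t       {[]}     _             _   = z≤n
lookupDefault≤⇒count≤ zero    {x ∷ xs} (xs≤x ∷ _)    x≤v = ≤-reflexive (count<≡0 (≤-refl ∷ xs≤x) x≤v)
lookupDefault≤⇒count≤ {v} (suc t) {x ∷ xs} (_ ∷ desc) ℓ≤v = begin
  count (v <?_) (x ∷ xs)         ≡⟨ count-∷ (v <?_) x xs ⟩
  𝟙 (v <? x) + count (v <?_) xs  ≤⟨ +-mono-≤ (𝟙≤1 (v <? x)) (lookupDefault≤⇒count≤ t desc ℓ≤v) ⟩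
  suc t                          ∎
  where open ≤-Reasoning

-- Layer cake: above each level v < V, xs has at most min(t, #{ℓ ∈ ℓs : v < ℓ})
-- entries, and the t largest entries of ℓs attain this at every level at once.
module _ {V t : ℕ} {ℓs xs : List ℕ} (ℓs-desc : Descending ℓs) (ℓs≤V : All (_≤ V) ℓs) (xs≤V : All (_≤ V) xs)
         (|xs|≤t : length xs ≤ t) (xs≼ℓs : ∀ v → count (v <?_) xs ≤ count (v <?_) ℓs) where

  private
    count≤t⊓count : ∀ v → count (v <?_) xs ≤ t ⊓ count (v <?_) ℓs
    count≤t⊓count v = ⊓-glb (≤-trans (count≤length (v <?_) xs) |xs|≤t) (xs≼ℓs v)

    layers : ∀ {_∼_ : ℕ → ℕ → Set} →
             (∑[ v ∈ downFrom V ] count (v <?_) xs) ∼ (∑[ v ∈ downFrom V ] (t ⊓ count (v <?_) ℓs)) →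
             sum xs ∼ sum (take t ℓs)
    layers {_∼_} = subst₂ _∼_ (sym (sum≡∑count V xs xs≤V)) (sym (sum-take≡∑⊓count V t ℓs-desc ℓs≤V))

  sum≤sum-take : sum xs ≤ sum (take t ℓs)
  sum≤sum-take = layers {_≤_} (∑-mono-≤ (downFrom V) λ {v} _ → count≤t⊓count v)

  sum<sum-take : ∀ {v} → v < V → count (v <?_) xs < t ⊓ count (v <?_) ℓs → sum xs < sum (take t ℓs)
  sum<sum-take v<V = layers {_<_} ∘ ∑-mono-< (downFrom V) (λ {v} _ → count≤t⊓count v) (∈-downFrom⁺ v<V)

-- Permutations, and those sorted by a key

insertions : A → List A → List (List A)
insertions x []       = (x ∷ []) ∷ []
insertions x (y ∷ ys) = (x ∷ y ∷ ys) ∷ map (y ∷_) (insertions x ys)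

permutations : List A → List (List A)
permutations []       = [] ∷ []
permutations (x ∷ xs) = concatMap (insertions x) (permutations xs)

∈-insertions⇒↭ : ∀ {x : A} {ρ} ys → ρ ∈ insertions x ys → ρ ↭ x ∷ ys
∈-insertions⇒↭ []       (here refl) = ↭-refl
∈-insertions⇒↭ (y ∷ ys) (here refl) = ↭-refl
∈-insertions⇒↭ {x = x} (y ∷ ys) (there ρ∈) with ∈-map⁻ (y ∷_) ρ∈
... | ρ′ , ρ′∈ , refl = ↭-trans (prep y (∈-insertions⇒↭ ys ρ′∈)) (swap y x ↭-refl)

∈-permutations⇒↭ : ∀ {σ} (xs : List A) → σ ∈ permutations xs → σ ↭ xs
∈-permutations⇒↭ []       (here refl) = ↭-refl
∈-permutations⇒↭ (x ∷ xs) σ∈ with find (∈-concatMap⁻ (insertions x) {xs = permutations xs} σ∈)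
... | τ , τ∈ , σ∈ins = ↭-trans (∈-insertions⇒↭ τ σ∈ins) (prep x (∈-permutations⇒↭ xs τ∈))

length-insertions : ∀ (x : A) ys → length (insertions x ys) ≡ suc (length ys)
length-insertions x []       = refl
length-insertions x (y ∷ ys) = cong suc (trans (length-map (y ∷_) (insertions x ys)) (length-insertions x ys))

length-permutations : ∀ (xs : List A) → length (permutations xs) ≡ length xs !
length-permutations []       = refl
length-permutations (x ∷ xs) = begin
  length (concatMap (insertions x) (permutations xs))     ≡⟨ length≡∑1 (concatMap (insertions x) (permutations xs)) ⟩
  ∑ (concatMap (insertions x) (permutations xs)) (λ _ → 1) ≡⟨ ∑-concatMap (permutations xs) (insertions x) _ ⟩
  ∑[ τ ∈ permutations xs ] ∑ (insertions x τ) (λ _ → 1)   ≡⟨ ∑-cong (permutations xs) (λ τ∈ → length-τ _ τ∈) ⟩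
  ∑[ τ ∈ permutations xs ] suc (length xs)                ≡⟨ ∑-const (permutations xs) _ ⟩
  length (permutations xs) * suc (length xs)              ≡⟨ cong (_* suc (length xs)) (length-permutations xs) ⟩
  length xs ! * suc (length xs)                           ≡⟨ *-comm (length xs !) _ ⟩
  suc (length xs) !                                       ∎
  where
  open ≡-Reasoning
  length-τ : ∀ τ → τ ∈ permutations xs → ∑ (insertions x τ) (λ _ → 1) ≡ suc (length xs)
  length-τ τ τ∈ = trans (sym (length≡∑1 (insertions x τ)))
    (trans (length-insertions x τ) (cong suc (↭.↭-length (∈-permutations⇒↭ xs τ∈))))

prodFact-tabulate-0 : ∀ p → prodFact (tabulate {n = p} (λ _ → 0)) ≡ 1
prodFact-tabulate-0 zero    = refl
prodFact-tabulate-0 (suc p) = trans (+-identityʳ _) (prodFact-tabulate-0 p)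

sum-tabulate-0 : ∀ p → Vec.sum (tabulate {n = p} (λ _ → 0)) ≡ 0
sum-tabulate-0 zero    = refl
sum-tabulate-0 (suc p) = sum-tabulate-0 p

prodFact-tabulate-incr : ∀ {p} (k₀ : Fin p) (h : Fin p → ℕ) →
                         prodFact (tabulate (λ k → 𝟙 (k₀ Finₚ.≟ k) + h k)) ≡ suc (h k₀) * prodFact (tabulate h)
prodFact-tabulate-incr zero      h = *-assoc (suc (h zero)) (h zero !) (prodFact (tabulate (h ∘ suc)))
prodFact-tabulate-incr (suc k₀) h = begin
  h zero ! * prodFact (tabulate (λ k → 𝟙 (k₀ Finₚ.≟ k) + h (suc k)))
    ≡⟨ cong (h zero ! *_) (prodFact-tabulate-incr k₀ (h ∘ suc)) ⟩
  h zero ! * (suc (h (suc k₀)) * prodFact (tabulate (h ∘ suc)))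
    ≡⟨ x∙yz≈y∙xz (h zero !) (suc (h (suc k₀))) (prodFact (tabulate (h ∘ suc))) ⟩
  suc (h (suc k₀)) * (h zero ! * prodFact (tabulate (h ∘ suc)))
    ∎
  where open ≡-Reasoning

sum-tabulate-incr : ∀ {p} (k₀ : Fin p) (h : Fin p → ℕ) →
                    Vec.sum (tabulate (λ k → 𝟙 (k₀ Finₚ.≟ k) + h k)) ≡ suc (Vec.sum (tabulate h))
sum-tabulate-incr zero      h = refl
sum-tabulate-incr (suc k₀) h = trans (cong (h zero +_) (sum-tabulate-incr k₀ (h ∘ suc))) (+-suc (h zero) _)

module _ {p : ℕ} (f : A → Fin p) where

  Sorted : List A → Set
  Sorted = AllPairs (λ x y → f x Fin.≤ f y)

  sorted? : Decidable Sorted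
  sorted? = allPairs? (λ x y → f x Finₚ.≤? f y)

  multiplicity : Fin p → List A → ℕ
  multiplicity k = count (λ x → f x Finₚ.≟ k)

  multiplicities : List A → Vec ℕ p
  multiplicities xs = tabulate (λ k → multiplicity k xs)

  multiplicities-∷ : ∀ x xs → multiplicities (x ∷ xs) ≡ tabulate (λ k → 𝟙 (f x Finₚ.≟ k) + multiplicity k xs)
  multiplicities-∷ x xs = tabulate-cong λ k → count-∷ (λ y → f y Finₚ.≟ k) x xs

  sum-multiplicities : ∀ xs → Vec.sum (multiplicities xs) ≡ length xs
  sum-multiplicities []       = sum-tabulate-0 p
  sum-multiplicities (x ∷ xs) = begin
    Vec.sum (multiplicities (x ∷ xs))                               ≡⟨ cong Vec.sum (multiplicities-∷ x xs) ⟩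
    Vec.sum (tabulate (λ k → 𝟙 (f x Finₚ.≟ k) + multiplicity k xs))  ≡⟨ sum-tabulate-incr (f x) (λ k → multiplicity k xs) ⟩
    suc (Vec.sum (multiplicities xs))                               ≡⟨ cong suc (sum-multiplicities xs) ⟩
    suc (length xs)                                                 ∎
    where open ≡-Reasoning

  insertions-sorted⁻ : ∀ {x ρ} τ → ρ ∈ insertions x τ → Sorted ρ → Sorted τ
  insertions-sorted⁻ []       _           _       = []
  insertions-sorted⁻ (y ∷ ys) (here refl) (_ ∷ s) = s
  insertions-sorted⁻ (y ∷ ys) (there ρ∈)  s with ∈-map⁻ (y ∷_) ρ∈ | s
  ... | ρ′ , ρ′∈ , refl | y≤ρ′ ∷ ρ′-sorted =
    All.tail (↭.All-resp-↭ (∈-insertions⇒↭ ys ρ′∈) y≤ρ′) ∷ insertions-sorted⁻ ys ρ′∈ ρ′-sorted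

  sorted⇒count-sorted-insertions : ∀ x {τ} → Sorted τ → count sorted? (insertions x τ) ≡ suc (multiplicity (f x) τ)
  sorted⇒count-sorted-insertions x {[]}     []                 = refl
  sorted⇒count-sorted-insertions x {y ∷ ys} (y≤ys ∷ ys-sorted) = begin
    count sorted? ((x ∷ y ∷ ys) ∷ map (y ∷_) (insertions x ys))
      ≡⟨ count-∷ sorted? (x ∷ y ∷ ys) (map (y ∷_) (insertions x ys)) ⟩
    𝟙 (sorted? (x ∷ y ∷ ys)) + count sorted? (map (y ∷_) (insertions x ys))
      ≡⟨ cong (𝟙 (sorted? (x ∷ y ∷ ys)) +_) (count-map sorted? (y ∷_) (insertions x ys)) ⟩
    𝟙 (sorted? (x ∷ y ∷ ys)) + count (sorted? ∘ (y ∷_)) (insertions x ys)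
      ≡⟨ by-order (Finₚ.<-cmp (f x) (f y)) ⟩
    suc (𝟙 (f y Finₚ.≟ f x) + multiplicity (f x) ys)
      ≡⟨ cong suc (count-∷ (λ z → f z Finₚ.≟ f x) y ys) ⟨
    suc (multiplicity (f x) (y ∷ ys))
      ∎
    where
    open ≡-Reasoning
    y≤ρ : ∀ {ρ} → ρ ∈ insertions x ys → f y Fin.≤ f x → All (λ z → f y Fin.≤ f z) ρ
    y≤ρ ρ∈ y≤x = ↭.All-resp-↭ (↭-sym (∈-insertions⇒↭ ys ρ∈)) (y≤x ∷ y≤ys)
    y∷-irrelevant : f y Fin.≤ f x → count (sorted? ∘ (y ∷_)) (insertions x ys) ≡ suc (multiplicity (f x) ys)
    y∷-irrelevant y≤x = trans (count-cong (sorted? ∘ (y ∷_)) sorted? (insertions x ys) (λ _ → AllPairs.tail)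
                                (λ ρ∈ ρ-sorted → y≤ρ ρ∈ y≤x ∷ ρ-sorted))
                              (sorted⇒count-sorted-insertions x ys-sorted)
    x∷y∷ys-sorted : f x Fin.≤ f y → Sorted (x ∷ y ∷ ys)
    x∷y∷ys-sorted x≤y = (x≤y ∷ All.map (≤-trans x≤y) y≤ys) ∷ y≤ys ∷ ys-sorted
    by-order : Tri (f x Fin.< f y) (f x ≡ f y) (f y Fin.< f x) →
               𝟙 (sorted? (x ∷ y ∷ ys)) + count (sorted? ∘ (y ∷_)) (insertions x ys) ≡
               suc (𝟙 (f y Finₚ.≟ f x) + multiplicity (f x) ys)
    by-order (tri< x<y x≢y _) = begin
      𝟙 (sorted? (x ∷ y ∷ ys)) + count (sorted? ∘ (y ∷_)) (insertions x ys)
        ≡⟨ cong₂ _+_ (𝟙-yes (x∷y∷ys-sorted (<⇒≤ x<y)) (sorted? (x ∷ y ∷ ys)))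
                     (count≡0 (sorted? ∘ (y ∷_)) λ ρ∈ y∷ρ-sorted →
                        <⇒≱ x<y (All.lookup (AllPairs.head y∷ρ-sorted) (x∈ρ ρ∈))) ⟩
      1
        ≡⟨ cong suc (cong₂ _+_ (𝟙-no (x≢y ∘ sym) (f y Finₚ.≟ f x))
                               (count≡0 (λ z → f z Finₚ.≟ f x) λ z∈ys fz≡fx →
                                  <⇒≱ x<y (subst (λ w → f y Fin.≤ w) fz≡fx (All.lookup y≤ys z∈ys)))) ⟨
      suc (𝟙 (f y Finₚ.≟ f x) + multiplicity (f x) ys)
        ∎
      where x∈ρ : ∀ {ρ} → ρ ∈ insertions x ys → x ∈ ρ
            x∈ρ ρ∈ = ↭.∈-resp-↭ (↭-sym (∈-insertions⇒↭ ys ρ∈)) (here refl)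
    by-order (tri≈ _ x≡y _) = begin
      𝟙 (sorted? (x ∷ y ∷ ys)) + count (sorted? ∘ (y ∷_)) (insertions x ys)
        ≡⟨ cong₂ _+_ (𝟙-yes (x∷y∷ys-sorted (≤-reflexive (cong toℕ x≡y))) (sorted? (x ∷ y ∷ ys)))
                     (y∷-irrelevant (≤-reflexive (cong toℕ (sym x≡y)))) ⟩
      suc (suc (multiplicity (f x) ys))
        ≡⟨ cong (λ b → suc (b + multiplicity (f x) ys)) (𝟙-yes (sym x≡y) (f y Finₚ.≟ f x)) ⟨
      suc (𝟙 (f y Finₚ.≟ f x) + multiplicity (f x) ys)
        ∎
    by-order (tri> _ x≢y y<x) = begin
      𝟙 (sorted? (x ∷ y ∷ ys)) + count (sorted? ∘ (y ∷_)) (insertions x ys)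
        ≡⟨ cong₂ _+_ (𝟙-no (λ { ((x≤y ∷ _) ∷ _) → <⇒≱ y<x x≤y }) (sorted? (x ∷ y ∷ ys)))
                     (y∷-irrelevant (<⇒≤ y<x)) ⟩
      suc (multiplicity (f x) ys)
        ≡⟨ cong (λ b → suc (b + multiplicity (f x) ys)) (𝟙-no (x≢y ∘ sym) (f y Finₚ.≟ f x)) ⟨
      suc (𝟙 (f y Finₚ.≟ f x) + multiplicity (f x) ys)
        ∎

  count-sorted-insertions : ∀ x τ → count sorted? (insertions x τ) ≡ 𝟙 (sorted? τ) * suc (multiplicity (f x) τ)
  count-sorted-insertions x τ with sorted? τ
  ... | yes τ-sorted = trans (sorted⇒count-sorted-insertions x τ-sorted) (sym (+-identityʳ _))
  ... | no  τ-unsorted = count≡0 sorted? λ ρ∈ ρ-sorted → τ-unsorted (insertions-sorted⁻ τ ρ∈ ρ-sorted)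

  count-sorted-permutations : ∀ xs → count sorted? (permutations xs) ≡ prodFact (multiplicities xs)
  count-sorted-permutations []       = sym (prodFact-tabulate-0 p)
  count-sorted-permutations (x ∷ xs) = begin
    count sorted? (concatMap (insertions x) (permutations xs))
      ≡⟨ count≡∑𝟙 sorted? (concatMap (insertions x) (permutations xs)) ⟩
    ∑ (concatMap (insertions x) (permutations xs)) (𝟙 ∘ sorted?)
      ≡⟨ ∑-concatMap (permutations xs) (insertions x) (𝟙 ∘ sorted?) ⟩
    ∑[ τ ∈ permutations xs ] ∑ (insertions x τ) (𝟙 ∘ sorted?)
      ≡⟨ ∑-cong (permutations xs) per-τ ⟩
    ∑[ τ ∈ permutations xs ] (𝟙 (sorted? τ) * suc (multiplicity (f x) xs))
      ≡⟨ ∑-𝟙* sorted? (permutations xs) _ ⟩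
    count sorted? (permutations xs) * suc (multiplicity (f x) xs)
      ≡⟨ cong (_* suc (multiplicity (f x) xs)) (count-sorted-permutations xs) ⟩
    prodFact (multiplicities xs) * suc (multiplicity (f x) xs)
      ≡⟨ *-comm (prodFact (multiplicities xs)) _ ⟩
    suc (multiplicity (f x) xs) * prodFact (multiplicities xs)
      ≡⟨ prodFact-tabulate-incr (f x) (λ k → multiplicity k xs) ⟨
    prodFact (tabulate (λ k → 𝟙 (f x Finₚ.≟ k) + multiplicity k xs))
      ≡⟨ cong prodFact (multiplicities-∷ x xs) ⟨
    prodFact (multiplicities (x ∷ xs))
      ∎
    where
    open ≡-Reasoning
    per-τ : ∀ {τ} → τ ∈ permutations xs →
            ∑ (insertions x τ) (𝟙 ∘ sorted?) ≡ 𝟙 (sorted? τ) * suc (multiplicity (f x) xs)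
    per-τ {τ} τ∈ = begin
      ∑ (insertions x τ) (𝟙 ∘ sorted?)               ≡⟨ count≡∑𝟙 sorted? (insertions x τ) ⟨
      count sorted? (insertions x τ)                 ≡⟨ count-sorted-insertions x τ ⟩
      𝟙 (sorted? τ) * suc (multiplicity (f x) τ)     ≡⟨ cong (λ c → 𝟙 (sorted? τ) * suc c) τ-multiplicity ⟩
      𝟙 (sorted? τ) * suc (multiplicity (f x) xs)    ∎
      where
      τ-multiplicity : multiplicity (f x) τ ≡ multiplicity (f x) xs
      τ-multiplicity = count-↭ (λ z → f z Finₚ.≟ f x) (∈-permutations⇒↭ xs τ∈)

module _ {p : ℕ} where

  sorted-head≤ : ∀ (f : A → Fin p) {x σ k} → Sorted f (x ∷ σ) → 0 < multiplicity f k (x ∷ σ) → f x Fin.≤ k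
  sorted-head≤ f {x} {σ} {k} (x≤σ ∷ _) k∈fσ with count>0 (λ y → f y Finₚ.≟ k) (x ∷ σ) k∈fσ
  ... | _ , here refl  , refl = ≤-refl
  ... | _ , there y∈σ , refl = All.lookup x≤σ y∈σ

  multiplicity-self>0 : ∀ (f : A → Fin p) x σ → 0 < multiplicity f (f x) (x ∷ σ)
  multiplicity-self>0 f x σ = subst (0 <_) (sym (count-∷ (λ y → f y Finₚ.≟ f x) x σ))
    (subst (λ c → 0 < c + multiplicity f (f x) σ) (sym (𝟙-yes refl (f x Finₚ.≟ f x))) (s≤s z≤n))

  sorted-unique : ∀ (f g : A → Fin p) σ → Sorted f σ → Sorted g σ →
                  (∀ k → multiplicity f k σ ≡ multiplicity g k σ) → ∀ {x} → x ∈ σ → f x ≡ g x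
  sorted-unique f g (x ∷ σ) f-sorted g-sorted same x∈ = on x∈
    where
    fx≡gx : f x ≡ g x
    fx≡gx = Finₚ.≤-antisym
      (sorted-head≤ f f-sorted (subst (0 <_) (sym (same (g x))) (multiplicity-self>0 g x σ)))
      (sorted-head≤ g g-sorted (subst (0 <_) (same (f x)) (multiplicity-self>0 f x σ)))
    same-tail : ∀ k → multiplicity f k σ ≡ multiplicity g k σ
    same-tail k = +-cancelˡ-≡ (𝟙 (f x Finₚ.≟ k)) _ _ (begin
      𝟙 (f x Finₚ.≟ k) + multiplicity f k σ  ≡⟨ count-∷ (λ y → f y Finₚ.≟ k) x σ ⟨
      multiplicity f k (x ∷ σ)               ≡⟨ same k ⟩
      multiplicity g k (x ∷ σ)               ≡⟨ count-∷ (λ y → g y Finₚ.≟ k) x σ ⟩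
      𝟙 (g x Finₚ.≟ k) + multiplicity g k σ  ≡⟨ cong (λ c → 𝟙 (c Finₚ.≟ k) + multiplicity g k σ) fx≡gx ⟨
      𝟙 (f x Finₚ.≟ k) + multiplicity g k σ  ∎)
      where open ≡-Reasoning
    on : ∀ {y} → y ∈ x ∷ σ → f y ≡ g y
    on (here refl) = fx≡gx
    on (there y∈σ) = sorted-unique f g σ (AllPairs.tail f-sorted) (AllPairs.tail g-sorted) same-tail y∈σ

-- Weak compositions

∣∣≡count : ∀ {n} (s : Subset n) → ∣ s ∣ ≡ count (_∈? s) (allFin n)
∣∣≡count []ᵥ              = refl
∣∣≡count {suc n} (b ∷ᵥ s) = begin
  ∣ b ∷ᵥ s ∣
    ≡⟨ head-and-tail b ⟩
  𝟙 (zero ∈? b ∷ᵥ s) + ∣ s ∣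
    ≡⟨ cong (𝟙 (zero ∈? b ∷ᵥ s) +_) (trans (∣∣≡count s) shift) ⟩
  𝟙 (zero ∈? b ∷ᵥ s) + count (_∈? b ∷ᵥ s) (map suc (allFin n))
    ≡⟨ cong (λ is → 𝟙 (zero ∈? b ∷ᵥ s) + count (_∈? b ∷ᵥ s) is) (map-tabulate id suc) ⟩
  𝟙 (zero ∈? b ∷ᵥ s) + count (_∈? b ∷ᵥ s) (List.tabulate suc)
    ≡⟨ count-∷ (_∈? b ∷ᵥ s) zero (List.tabulate suc) ⟨
  count (_∈? b ∷ᵥ s) (allFin (suc n))
    ∎
  where
  open ≡-Reasoning
  head-and-tail : ∀ b → ∣ b ∷ᵥ s ∣ ≡ 𝟙 (zero ∈? b ∷ᵥ s) + ∣ s ∣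
  head-and-tail inside  = refl
  head-and-tail outside = refl
  shift : count (_∈? s) (allFin n) ≡ count (_∈? b ∷ᵥ s) (map suc (allFin n))
  shift = trans (count-cong (_∈? s) (λ i → suc i ∈? b ∷ᵥ s) (allFin n) (λ _ → Vec.there) (λ _ → drop-there))
                (sym (count-map (_∈? b ∷ᵥ s) suc (allFin n)))

Comparable : ∀ {n} → Subset n → Subset n → Set
Comparable a b = a ⊆ₛ b ⊎ b ⊆ₛ a

uncrossed⇒comparable : ∀ {n} (a b : Subset n) → (∀ {x y} → x ∈ₛ a → x ∉ₛ b → y ∈ₛ b → y ∉ₛ a → ⊥) →
                       Comparable a b
uncrossed⇒comparable a b uncrossed with Finₚ.any? (λ x → x ∈? a ×-dec ¬? (x ∈? b))
... | yes (x , x∈a , x∉b) = inj₂ λ {y} y∈b → decidable-stable (y ∈? a) (uncrossed x∈a x∉b y∈b)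
... | no  ∄x               = inj₁ λ {x} x∈a → decidable-stable (x ∈? b) λ x∉b → ∄x (x , x∈a , x∉b)

prodFact∣sum! : ∀ {p} (a : Vec ℕ p) → prodFact a ∣ Vec.sum a !
prodFact∣sum! []ᵥ         = ∣-refl
prodFact∣sum! (a₀ ∷ᵥ as) = ∣-trans (*-monoʳ-∣ (a₀ !) (prodFact∣sum! as))
  (subst (λ s → a₀ ! * s ! ∣ (a₀ + Vec.sum as) !) (m+n∸m≡n a₀ (Vec.sum as)) (k![n∸k]!∣n! (m≤m+n a₀ (Vec.sum as))))

multinomial*prodFact : ∀ {p} (a : Vec ℕ p) → multinomial (Vec.sum a) a * prodFact a ≡ Vec.sum a !
multinomial*prodFact a = m/n*n≡m {{prodFact≢0 a}} (prodFact∣sum! a)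

multinomial≤! : ∀ {p} n (a : Vec ℕ p) → multinomial n a ≤ n !
multinomial≤! n a = m/n≤m (n !) (prodFact a) {{prodFact≢0 a}}

∈-shapes : ∀ {p} (a : Vec ℕ p) → a ∈ shapes p (Vec.sum a)
∈-shapes []ᵥ         = here refl
∈-shapes {suc p} (a₀ ∷ᵥ as) = ∈-concatMap⁺ (λ b → map (b ∷ᵥ_) (shapes p (a₀ + Vec.sum as ∸ b)))
  (Any.map (λ { refl → ∈-map⁺ (a₀ ∷ᵥ_) as∈ }) (∈-upTo⁺ (s≤s (m≤m+n a₀ (Vec.sum as)))))
  where
  as∈ : as ∈ shapes p (a₀ + Vec.sum as ∸ a₀)
  as∈ = subst (λ s → as ∈ shapes p s) (sym (m+n∸m≡n a₀ (Vec.sum as))) (∈-shapes as)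

module _ {n p : ℕ} where

  partOf : WeakComposition n p → Fin n → Fin p
  partOf W x = proj₁ (covers W x)

  ∈-part-partOf : ∀ (W : WeakComposition n p) x → x ∈ₛ part W (partOf W x)
  ∈-part-partOf W x = proj₂ (covers W x)

  partOf-unique : ∀ (W : WeakComposition n p) {x k} → x ∈ₛ part W k → partOf W x ≡ k
  partOf-unique W {x} x∈k = disjoint W _ _ x (∈-part-partOf W x) x∈k

  partOf⇒∈ : ∀ (W : WeakComposition n p) {x k} → partOf W x ≡ k → x ∈ₛ part W k
  partOf⇒∈ W {x} refl = ∈-part-partOf W x

  partOf≗⇒part≡ : ∀ (W₁ W₂ : WeakComposition n p) → (∀ x → partOf W₁ x ≡ partOf W₂ x) →
                  ∀ k → part W₁ k ≡ part W₂ k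
  partOf≗⇒part≡ W₁ W₂ same k = ⊆-antisym (λ x∈ → partOf⇒∈ W₂ (trans (sym (same _)) (partOf-unique W₁ x∈)))
                                  (λ x∈ → partOf⇒∈ W₁ (trans (same _) (partOf-unique W₂ x∈)))

  shape≡multiplicities : ∀ (W : WeakComposition n p) → shape W ≡ multiplicities (partOf W) (allFin n)
  shape≡multiplicities W = tabulate-cong λ k → trans (∣∣≡count (part W k))
    (count-cong (_∈? part W k) (λ x → partOf W x Finₚ.≟ k) (allFin n) (λ _ → partOf-unique W) (λ _ → partOf⇒∈ W))

  sum-shape : ∀ (W : WeakComposition n p) → Vec.sum (shape W) ≡ n
  sum-shape W = begin
    Vec.sum (shape W)                                ≡⟨ cong Vec.sum (shape≡multiplicities W) ⟩
    Vec.sum (multiplicities (partOf W) (allFin n))   ≡⟨ sum-multiplicities (partOf W) (allFin n) ⟩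
    length (allFin n)                                ≡⟨ length-allFin n ⟩
    n                                                ∎
    where open ≡-Reasoning

  prodFact-shape : ∀ (W : WeakComposition n p) →
                   prodFact (shape W) ≡ count (sorted? (partOf W)) (permutations (allFin n))
  prodFact-shape W = trans (cong prodFact (shape≡multiplicities W)) (sym (count-sorted-permutations (partOf W) (allFin n)))

  multinomial-shape*prodFact : ∀ (W : WeakComposition n p) → multinomial n (shape W) * prodFact (shape W) ≡ n !
  multinomial-shape*prodFact W with Vec.sum (shape W) | sum-shape W | multinomial*prodFact (shape W)
  ... | _ | refl | eq = eq

  shape∈shapes : ∀ (W : WeakComposition n p) → shape W ∈ shapes p n
  shape∈shapes W = subst (λ s → shape W ∈ shapes p s) (sum-shape W) (∈-shapes (shape W))

  AgreeBelow : WeakComposition n p → WeakComposition n p → Fin p → Set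
  AgreeBelow W₁ W₂ K = ∀ k → k Fin.< K → part W₁ k ≡ part W₂ k

  agreeBelow-sym : ∀ {W₁ W₂ : WeakComposition n p} {K} → AgreeBelow W₁ W₂ K → AgreeBelow W₂ W₁ K
  agreeBelow-sym agree k k<K = sym (agree k k<K)

  partOf-agree : ∀ (W₁ W₂ : WeakComposition n p) {K x} → AgreeBelow W₁ W₂ K →
                 partOf W₁ x Fin.< K → partOf W₂ x ≡ partOf W₁ x
  partOf-agree W₁ W₂ {x = x} agree x<K = partOf-unique W₂ (subst (x ∈ₛ_) (agree _ x<K) (∈-part-partOf W₁ x))

  leaves-upward : ∀ (W₁ W₂ : WeakComposition n p) {K x} → AgreeBelow W₁ W₂ K →
                  x ∈ₛ part W₁ K → x ∉ₛ part W₂ K → K Fin.< partOf W₂ x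
  leaves-upward W₁ W₂ {K} {x} agree x∈₁ x∉₂ with Finₚ.<-cmp (partOf W₂ x) K
  ... | tri< f₂x<K _ _ = ⊥-elim (Finₚ.<-irrefl f₂x≡K f₂x<K)
    where
    f₂x≡K : partOf W₂ x ≡ K
    f₂x≡K = trans (sym (partOf-agree W₂ W₁ (agreeBelow-sym {W₁ = W₁} {W₂} agree) f₂x<K)) (partOf-unique W₁ x∈₁)
  ... | tri≈ _ f₂x≡K _ = ⊥-elim (x∉₂ (partOf⇒∈ W₂ f₂x≡K))
  ... | tri> _ _ K<f₂x = K<f₂x

agreeBelow-last⇒part≡ : ∀ {n q} (W₁ W₂ : WeakComposition n (suc q)) → AgreeBelow W₁ W₂ (fromℕ q) →
                        ∀ k → part W₁ k ≡ part W₂ k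
agreeBelow-last⇒part≡ W₁ W₂ agree = partOf≗⇒part≡ W₁ W₂ λ x → by-order x (Finₚ.<-cmp (partOf W₁ x) (partOf W₂ x))
  where
  by-order : ∀ x → Tri _ _ _ → partOf W₁ x ≡ partOf W₂ x
  by-order x (tri< f₁<f₂ _ _) = sym (partOf-agree W₁ W₂ agree (<-≤-trans f₁<f₂ (Finₚ.≤fromℕ (partOf W₂ x))))
  by-order x (tri≈ _ f₁≡f₂ _) = f₁≡f₂
  by-order x (tri> _ _ f₂<f₁) =
    partOf-agree W₂ W₁ (agreeBelow-sym {W₁ = W₁} {W₂} agree) (<-≤-trans f₂<f₁ (Finₚ.≤fromℕ (partOf W₁ x)))

module _ {n p : ℕ} {σ : List (Fin n)} (σ↭ : σ ↭ allFin n) (W₁ W₂ : WeakComposition n p)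
         (W₁-sorted : Sorted (partOf W₁) σ) (W₂-sorted : Sorted (partOf W₂) σ) where

  private
    ∈σ : ∀ x → x ∈ σ
    ∈σ x = ↭.∈-resp-↭ (↭-sym σ↭) (∈-allFin x)

    multiplicity≡shape : ∀ (W : WeakComposition n p) k → multiplicity (partOf W) k σ ≡ Vec.lookup (shape W) k
    multiplicity≡shape W k = begin
      multiplicity (partOf W) k σ
        ≡⟨ count-↭ (λ x → partOf W x Finₚ.≟ k) σ↭ ⟩
      multiplicity (partOf W) k (allFin n)
        ≡⟨ lookup∘tabulate (λ k → multiplicity (partOf W) k (allFin n)) k ⟨
      Vec.lookup (multiplicities (partOf W) (allFin n)) k
        ≡⟨ cong (λ v → Vec.lookup v k) (shape≡multiplicities W) ⟨
      Vec.lookup (shape W) k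
        ∎
      where open ≡-Reasoning

  sorted-shape-injective : shape W₁ ≡ shape W₂ → ∀ k → part W₁ k ≡ part W₂ k
  sorted-shape-injective shape≡ = partOf≗⇒part≡ W₁ W₂ λ x →
    sorted-unique (partOf W₁) (partOf W₂) σ W₁-sorted W₂-sorted
      (λ k → trans (multiplicity≡shape W₁ k) (trans (cong (λ v → Vec.lookup v k) shape≡) (sym (multiplicity≡shape W₂ k))))
      (∈σ x)

  -- An element of A₁K∖A₂K lies beyond part K in W₂ and one of A₂K∖A₁K lies beyond
  -- part K in W₁, so σ cannot list the two in an order compatible with both.
  sorted-parts-comparable : ∀ {K} → AgreeBelow W₁ W₂ K → Comparable (part W₁ K) (part W₂ K)
  sorted-parts-comparable agree = uncrossed⇒comparable _ _ λ {x} {y} x∈₁ x∉₂ y∈₂ y∉₁ →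
    let K<f₂x = leaves-upward W₁ W₂ agree x∈₁ x∉₂
        K<f₁y = leaves-upward W₂ W₁ (agreeBelow-sym {W₁ = W₁} {W₂} agree) y∈₂ y∉₁
    in case ∈-AllPairs₂ (AllPairs.zip (W₁-sorted , W₂-sorted)) (∈σ x) (∈σ y) of λ where
      (inj₁ refl)                 → y∉₁ x∈₁
      (inj₂ (inj₁ (_ , f₂x≤f₂y))) → <⇒≱ K<f₂x (subst (partOf W₂ x Fin.≤_) (partOf-unique W₂ y∈₂) f₂x≤f₂y)
      (inj₂ (inj₂ (f₁y≤f₁x , _))) → <⇒≱ K<f₁y (subst (partOf W₁ y Fin.≤_) (partOf-unique W₁ x∈₁) f₁y≤f₁x)

-- Bounding a family by its chains

module _ {J K : Set} (_≟_ : DecidableEquality K) where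

  length≤width*fibre : ∀ (κ : J → K) w B (Q : List J) →
    (∀ {j} → j ∈ Q → count (λ j′ → κ j′ ≟ κ j) Q ≤ B) →
    (∀ R → (∀ {j} → j ∈ R → j ∈ Q) → AllPairs (λ a b → κ a ≢ κ b) R → length R ≤ w) →
    length Q ≤ w * B
  length≤width*fibre κ w       B []      _       _     = z≤n
  length≤width*fibre κ zero    B (j ∷ Q) _       width with width (j ∷ []) (λ { (here refl) → here refl }) ([] ∷ [])
  ... | ()
  length≤width*fibre κ (suc w) B (j ∷ Q) fibre≤B width = begin
    length (j ∷ Q)
      ≡⟨ count+count¬ same? (j ∷ Q) ⟨
    count same? (j ∷ Q) + count (¬? ∘ same?) (j ∷ Q)
      ≡⟨ cong (count same? (j ∷ Q) +_) (count-∷ (¬? ∘ same?) j Q) ⟩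
    count same? (j ∷ Q) + (𝟙 (¬? (same? j)) + length rest)
      ≡⟨ cong (λ c → count same? (j ∷ Q) + (c + length rest)) (𝟙-no (λ ¬refl → ¬refl refl) (¬? (same? j))) ⟩
    count same? (j ∷ Q) + length rest
      ≤⟨ +-mono-≤ (fibre≤B (here refl)) (length≤width*fibre κ w B rest fibre≤B′ width′) ⟩
    B + w * B
      ∎
    where
    open ≤-Reasoning
    same? : Decidable (λ j′ → κ j′ ≡ κ j)
    same? j′ = κ j′ ≟ κ j
    rest : List J
    rest = filter (¬? ∘ same?) Q
    fibre≤B′ : ∀ {j₁} → j₁ ∈ rest → count (λ j′ → κ j′ ≟ κ j₁) rest ≤ B
    fibre≤B′ {j₁} j₁∈ = ≤-trans (count-filter≤ (λ j′ → κ j′ ≟ κ j₁) (¬? ∘ same?) Q)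
                   (≤-trans (count≤count-∷ (λ j′ → κ j′ ≟ κ j₁) j Q)
                            (fibre≤B (there (proj₁ (∈-filter⁻ (¬? ∘ same?) {xs = Q} j₁∈)))))
    width′ : ∀ R → (∀ {j₁} → j₁ ∈ R → j₁ ∈ rest) → AllPairs (λ a b → κ a ≢ κ b) R → length R ≤ w
    width′ R R⊆rest distinct = s≤s⁻¹ (width (j ∷ R) j∷R⊆Q (All.tabulate κj≢ ∷ distinct))
      where
      j∷R⊆Q : ∀ {j₁} → j₁ ∈ j ∷ R → j₁ ∈ j ∷ Q
      j∷R⊆Q (here refl) = here refl
      j∷R⊆Q (there j₁∈) = there (proj₁ (∈-filter⁻ (¬? ∘ same?) {xs = Q} (R⊆rest j₁∈)))
      κj≢ : ∀ {j₁} → j₁ ∈ R → κ j ≢ κ j₁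
      κj≢ j₁∈ = ≢-sym (proj₂ (∈-filter⁻ (¬? ∘ same?) {xs = Q} (R⊆rest j₁∈)))

  -- Q splits by its first coordinate into at most r fibres, each a smaller instance.
  chain-bound : ∀ (r : ℕ) {q} (g : Fin q → J → K) (Q : List J) → Unique Q →
    (∀ {j j′} → j ∈ Q → j′ ∈ Q → (∀ i → g i j ≡ g i j′) → j ≡ j′) →
    (∀ i (R : List J) → (∀ {j} → j ∈ R → j ∈ Q) →
       (∀ {j j′} → j ∈ R → j′ ∈ R → ∀ i′ → i′ Fin.< i → g i′ j ≡ g i′ j′) →
       AllPairs (λ a b → g i a ≢ g i b) R → length R ≤ r) →
    length Q ≤ r ^ q
  chain-bound r {zero}  g []      _  _   _     = z≤n
  chain-bound r {zero}  g (j ∷ Q) Q! inj _     =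
    Unique-⊆⇒length≤ {ys = j ∷ []} Q! λ j′∈ → here (inj j′∈ (here refl) λ ())
  chain-bound r {suc q} g Q       Q! inj width =
    length≤width*fibre (g zero) r (r ^ q) Q fibre≤ λ R R⊆Q → width zero R R⊆Q λ _ _ _ ()
    where
    fibre≤ : ∀ {j} → j ∈ Q → count (λ j′ → g zero j′ ≟ g zero j) Q ≤ r ^ q
    fibre≤ {j} _ = chain-bound r (g ∘ suc) fibre (Unique.filter⁺ same? Q!) inj′ width′
      where
      same? : Decidable (λ j′ → g zero j′ ≡ g zero j)
      same? j′ = g zero j′ ≟ g zero j
      fibre : List J
      fibre = filter same? Q
      ∈Q : ∀ {j′} → j′ ∈ fibre → j′ ∈ Q
      ∈Q = proj₁ ∘ ∈-filter⁻ same? {xs = Q}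
      agree₀ : ∀ {j₁ j₂} → j₁ ∈ fibre → j₂ ∈ fibre → g zero j₁ ≡ g zero j₂
      agree₀ j₁∈ j₂∈ = trans (proj₂ (∈-filter⁻ same? {xs = Q} j₁∈))
                             (sym (proj₂ (∈-filter⁻ same? {xs = Q} j₂∈)))
      inj′ : ∀ {j₁ j₂} → j₁ ∈ fibre → j₂ ∈ fibre → (∀ i → g (suc i) j₁ ≡ g (suc i) j₂) → j₁ ≡ j₂
      inj′ j₁∈ j₂∈ agree = inj (∈Q j₁∈) (∈Q j₂∈) λ { zero → agree₀ j₁∈ j₂∈ ; (suc i) → agree i }
      width′ : ∀ i R → (∀ {j₁} → j₁ ∈ R → j₁ ∈ fibre) →
               (∀ {j₁ j₂} → j₁ ∈ R → j₂ ∈ R → ∀ i′ → i′ Fin.< i → g (suc i′) j₁ ≡ g (suc i′) j₂) →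
               AllPairs (λ a b → g (suc i) a ≢ g (suc i) b) R → length R ≤ r
      width′ i R R⊆fibre agree = width (suc i) R (∈Q ∘ R⊆fibre) λ j₁∈ j₂∈ → λ where
        zero      _         → agree₀ (R⊆fibre j₁∈) (R⊆fibre j₂∈)
        (suc i′) (s≤s i′<i) → agree j₁∈ j₂∈ i′ i′<i

<inject₁⇒inject₁ : ∀ {q} {k : Fin (suc q)} {i : Fin q} → k Fin.< inject₁ i →
                   ∃ λ i′ → inject₁ i′ ≡ k × i′ Fin.< i
<inject₁⇒inject₁ {k = zero}  {suc i} _         = zero , refl , s≤s z≤n
<inject₁⇒inject₁ {k = suc k} {suc i} (s≤s k<i) =
  let i′ , i′≡k , i′<i = <inject₁⇒inject₁ k<i in suc i′ , cong suc i′≡k , s≤s i′<i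

<fromℕ⇒inject₁ : ∀ {q} {k : Fin (suc q)} → k Fin.< fromℕ q → ∃ λ i → inject₁ i ≡ k
<fromℕ⇒inject₁ {suc q} {zero}  _         = zero , refl
<fromℕ⇒inject₁ {suc q} {suc k} (s≤s k<q) = let i , i≡k = <fromℕ⇒inject₁ k<q in suc i , cong suc i≡k

-- Double counting

module DoubleCounting {n r q m : ℕ} (F : Fin m → WeakComposition n (suc q)) (F-distinct : Distinct F)
  (F-chain-free : ∀ (k : Fin (suc q)) → suc (toℕ k) < suc q → ChainFree r (λ j → part (F j) k)) where

  t : ℕ
  t = r ^ q

  ℓs : List ℕ
  ℓs = sortedMultinomials n (suc q)

  T : ℕ
  T = sum (take t ℓs)

  c : Fin m → ℕ
  c j = multinomial n (shape (F j))

  Perms : List (List (Fin n))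
  Perms = permutations (allFin n)

  compatible? : ∀ σ → Decidable (λ j → Sorted (partOf (F j)) σ)
  compatible? σ j = sorted? (partOf (F j)) σ

  members : List (Fin n) → List (Fin m)
  members σ = filter (compatible? σ) (allFin m)

  values : List (Fin n) → List ℕ
  values σ = map c (members σ)

  private
    module _ {σ : List (Fin n)} where
      ∈members⁻ : ∀ {j} → j ∈ members σ → Sorted (partOf (F j)) σ
      ∈members⁻ = proj₂ ∘ ∈-filter⁻ (compatible? σ) {xs = allFin m}

    F-injective : ∀ {j j′} → (∀ k → part (F j) k ≡ part (F j′) k) → j ≡ j′
    F-injective {j} {j′} same with j Finₚ.≟ j′
    ... | yes j≡j′ = j≡j′
    ... | no  j≢j′ = let k , differ = F-distinct j j′ j≢j′ in ⊥-elim (differ (same k))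

    ℓs↭ : ℓs ↭ map (multinomial n) (shapes (suc q) n)
    ℓs↭ = InsertionSort.sort-↭ ≥-decTotalOrder (map (multinomial n) (shapes (suc q) n))

    ℓs-descending : Descending ℓs
    ℓs-descending = Linked⇒AllPairs (λ b≤a c≤b → ≤-trans c≤b b≤a)
      (InsertionSort.sort-↗ ≥-decTotalOrder (map (multinomial n) (shapes (suc q) n)))

    ℓs≤n! : All (_≤ n !) ℓs
    ℓs≤n! = ↭.All-resp-↭ (↭-sym ℓs↭) (All.map⁺ (All.tabulate λ {a} _ → multinomial≤! n a))

    count-ℓs : ∀ v → count (v <?_) ℓs ≡ count (λ a → v <? multinomial n a) (shapes (suc q) n)
    count-ℓs v = trans (count-↭ (v <?_) ℓs↭) (count-map (v <?_) (multinomial n) (shapes (suc q) n))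

  module _ {σ} (σ∈ : σ ∈ Perms) where

    private
      σ↭ : σ ↭ allFin n
      σ↭ = ∈-permutations⇒↭ (allFin n) σ∈

      members-Unique : Unique (members σ)
      members-Unique = Unique.filter⁺ (compatible? σ) (Unique.allFin⁺ m)

      shapes-Unique : Unique (map (shape ∘ F) (members σ))
      shapes-Unique = Unique-map⁺ (shape ∘ F) members-Unique λ j∈ j′∈ shape≡ →
        F-injective (sorted-shape-injective σ↭ (F _) (F _) (∈members⁻ j∈) (∈members⁻ j′∈) shape≡)

    length-members≤t : length (members σ) ≤ t
    length-members≤t =
      chain-bound (≡-dec Bool._≟_) r (λ i j → part (F j) (inject₁ i)) (members σ) members-Unique determined width
      where
      determined : ∀ {j j′} → j ∈ members σ → j′ ∈ members σ →
                   (∀ i → part (F j) (inject₁ i) ≡ part (F j′) (inject₁ i)) → j ≡ j′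
      determined _ _ agree = F-injective (agreeBelow-last⇒part≡ (F _) (F _) λ k k<last →
        let i , i≡k = <fromℕ⇒inject₁ k<last in subst (λ k → part (F _) k ≡ part (F _) k) i≡k (agree i))
      width : ∀ i R → (∀ {j} → j ∈ R → j ∈ members σ) →
              (∀ {j j′} → j ∈ R → j′ ∈ R → ∀ i′ → i′ Fin.< i →
                 part (F j) (inject₁ i′) ≡ part (F j′) (inject₁ i′)) →
              AllPairs (λ a b → part (F a) (inject₁ i) ≢ part (F b) (inject₁ i)) R → length R ≤ r
      width i R R⊆ agree distinct = F-chain-free (inject₁ i) (s≤s (Finₚ.inject₁ℕ< i)) (length R) (List.lookup R)
        ( (λ a b a≢b → AllPairs-lookup ≢-sym distinct a≢b)
        , (λ a b → sorted-parts-comparable σ↭ (F _) (F _) (∈members⁻ (R⊆ (∈-lookup a))) (∈members⁻ (R⊆ (∈-lookup b)))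
                     λ k k<i → let i′ , i′≡k , i′<i = <inject₁⇒inject₁ k<i in
                       subst (λ k → part (F _) k ≡ part (F _) k) i′≡k (agree (∈-lookup a) (∈-lookup b) i′ i′<i)) )

    length-values≤t : length (values σ) ≤ t
    length-values≤t = ≤-trans (≤-reflexive (length-map c (members σ))) length-members≤t

    private
      count-values : ∀ v → count (v <?_) (values σ) ≡ count (λ a → v <? multinomial n a) (map (shape ∘ F) (members σ))
      count-values v = trans (count-map (v <?_) c (members σ)) (sym (count-map (λ a → v <? multinomial n a) (shape ∘ F) (members σ)))

      shapes-dominated : ∀ {ws} v → Unique ws → (∀ {w} → w ∈ ws → w ∈ shapes (suc q) n) →
                         count (λ a → v <? multinomial n a) ws ≤ count (v <?_) ℓs
      shapes-dominated {ws} v ws! ws⊆ = subst (count (λ a → v <? multinomial n a) ws ≤_) (sym (count-ℓs v))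
        (count-mono-Unique (λ a → v <? multinomial n a) ws! λ w∈ _ → ws⊆ w∈)

      shape-members∈shapes : ∀ {w} → w ∈ map (shape ∘ F) (members σ) → w ∈ shapes (suc q) n
      shape-members∈shapes w∈ with ∈-map⁻ (shape ∘ F) w∈
      ... | j , _ , refl = shape∈shapes (F j)

    values≼ℓs : ∀ v → count (v <?_) (values σ) ≤ count (v <?_) ℓs
    values≼ℓs v = subst (_≤ count (v <?_) ℓs) (sym (count-values v)) (shapes-dominated v shapes-Unique shape-members∈shapes)

    values≤n! : All (_≤ n !) (values σ)
    values≤n! = All.map⁺ (All.tabulate λ {j} _ → multinomial≤! n (shape (F j)))

    sum-values≤T : sum (values σ) ≤ T
    sum-values≤T = sum≤sum-take ℓs-descending ℓs≤n! values≤n! length-values≤t values≼ℓs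

    sum-values<T : ∀ {v} → v < n ! → count (v <?_) (values σ) < t ⊓ count (v <?_) ℓs → sum (values σ) < T
    sum-values<T = sum<sum-take ℓs-descending ℓs≤n! values≤n! length-values≤t values≼ℓs

    missing-shape⇒count< : ∀ (W : WeakComposition n (suc q)) → Sorted (partOf W) σ → ¬ Contains F W →
                           ∀ {v} → v < multinomial n (shape W) → count (v <?_) (values σ) < count (v <?_) ℓs
    missing-shape⇒count< W W-sorted W∉F {v} v<W = begin-strict
      count (v <?_) (values σ)                                          ≡⟨ count-values v ⟩
      count (λ a → v <? multinomial n a) (map (shape ∘ F) (members σ))  <⟨ n<1+n _ ⟩
      suc (count (λ a → v <? multinomial n a) (map (shape ∘ F) (members σ)))
        ≡⟨ cong (_+ count (λ a → v <? multinomial n a) (map (shape ∘ F) (members σ)))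
                (𝟙-yes v<W (v <? multinomial n (shape W))) ⟨
      𝟙 (v <? multinomial n (shape W)) + count (λ a → v <? multinomial n a) (map (shape ∘ F) (members σ))
        ≡⟨ count-∷ (λ a → v <? multinomial n a) (shape W) _ ⟨
      count (λ a → v <? multinomial n a) (shape W ∷ map (shape ∘ F) (members σ))
        ≤⟨ shapes-dominated v (All.tabulate W-new ∷ shapes-Unique)
             (λ { (here refl) → shape∈shapes W ; (there w∈) → shape-members∈shapes w∈ }) ⟩
      count (v <?_) ℓs ∎
      where
      open ≤-Reasoning
      W-new : ∀ {w} → w ∈ map (shape ∘ F) (members σ) → shape W ≢ w
      W-new w∈ shape≡ with ∈-map⁻ (shape ∘ F) w∈
      ... | j , j∈ , refl = W∉F (j , λ k → sym (sorted-shape-injective σ↭ W (F j) W-sorted (∈members⁻ j∈) shape≡ k))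

  private
    ∑-values≡m*n! : ∑[ σ ∈ Perms ] sum (values σ) ≡ m * n !
    ∑-values≡m*n! = begin
      ∑[ σ ∈ Perms ] ∑ (members σ) c
        ≡⟨ ∑-cong Perms (λ {σ} _ → ∑-filter (compatible? σ) c (allFin m)) ⟩
      ∑[ σ ∈ Perms ] ∑[ j ∈ allFin m ] (𝟙 (compatible? σ j) * c j)
        ≡⟨ ∑-comm Perms (allFin m) (λ σ j → 𝟙 (compatible? σ j) * c j) ⟩
      ∑[ j ∈ allFin m ] ∑[ σ ∈ Perms ] (𝟙 (compatible? σ j) * c j)
        ≡⟨ ∑-cong (allFin m) (λ {j} _ → per-member j) ⟩
      ∑[ j ∈ allFin m ] (n !)
        ≡⟨ ∑-const (allFin m) (n !) ⟩
      length (allFin m) * n !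
        ≡⟨ cong (_* n !) (length-allFin m) ⟩
      m * n !
        ∎
      where
      open ≡-Reasoning
      per-member : ∀ j → ∑[ σ ∈ Perms ] (𝟙 (compatible? σ j) * c j) ≡ n !
      per-member j = begin
        ∑[ σ ∈ Perms ] (𝟙 (compatible? σ j) * c j)  ≡⟨ ∑-𝟙* (sorted? (partOf (F j))) Perms (c j) ⟩
        count (sorted? (partOf (F j))) Perms * c j            ≡⟨ cong (_* c j) (prodFact-shape (F j)) ⟨
        prodFact (shape (F j)) * c j                          ≡⟨ *-comm (prodFact (shape (F j))) (c j) ⟩
        c j * prodFact (shape (F j))                          ≡⟨ multinomial-shape*prodFact (F j) ⟩
        n !                                                   ∎

    sum-values≮T : m ≡ T → ∀ {σ} → σ ∈ Perms → ¬ sum (values σ) < T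
    sum-values≮T m≡T σ∈ S<T = <-irrefl refl (begin-strict
      m * n !                         ≡⟨ ∑-values≡m*n! ⟨
      ∑[ σ ∈ Perms ] sum (values σ)   <⟨ ∑-mono-< Perms sum-values≤T σ∈ S<T ⟩
      ∑[ σ ∈ Perms ] T                ≡⟨ ∑-const Perms T ⟩
      length Perms * T                ≡⟨ cong (_* T) (trans (length-permutations (allFin n)) (cong _! (length-allFin n))) ⟩
      n ! * T                         ≡⟨ cong (n ! *_) m≡T ⟨
      n ! * m                         ≡⟨ *-comm (n !) m ⟩
      m * n !                         ∎)
      where open ≤-Reasoning

    sorting-permutation : ∀ (W : WeakComposition n (suc q)) → ∃ λ σ → σ ∈ Perms × Sorted (partOf W) σ
    sorting-permutation W = count>0 (sorted? (partOf W)) Perms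
      (subst (0 <_) (prodFact-shape W) (>-nonZero⁻¹ _ {{prodFact≢0 (shape W)}}))

    M≤n! : ∀ i → M n (suc q) i ≤ n !
    M≤n! zero    = z≤n
    M≤n! (suc i) = lookupDefault≤ ℓs i ℓs≤n!

    <M⇒≤count : ∀ s {v} → v < M n (suc q) s → s ≤ count (v <?_) ℓs
    <M⇒≤count zero    _     = z≤n
    <M⇒≤count (suc s) v<M = <lookupDefault⇒<count s ℓs-descending v<M

    contains? : ∀ W → Dec (Contains F W)
    contains? W = Finₚ.any? λ j → Finₚ.all? λ k → ≡-dec Bool._≟_ (part (F j) k) (part W k)

  members-large : m ≡ T → ∀ j → M n (suc q) t ≤ c j
  members-large m≡T j = decidable-stable (M n (suc q) t ≤? c j) (small-member ∘ ≰⇒>)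
    where
    small-member : c j < M n (suc q) t → ⊥
    small-member c<M with sorting-permutation (F j)
    ... | σ , σ∈ , j-sorted =
      sum-values≮T m≡T σ∈ (sum-values<T σ∈ (<-≤-trans c<M (M≤n! t))
                                           (⊓-glb count<t (<-≤-trans count<t (<M⇒≤count t c<M))))
      where
      c∈values : c j ∈ values σ
      c∈values = ∈-map⁺ c (∈-filter⁺ (compatible? σ) (∈-allFin j) j-sorted)
      count<t : count (c j <?_) (values σ) < t
      count<t = <-≤-trans (count<length (c j <?_) c∈values (<-irrefl refl)) (length-values≤t σ∈)

  large-contained : m ≡ T → ∀ W → M n (suc q) (suc t) < multinomial n (shape W) → Contains F W
  large-contained m≡T W M<W = decidable-stable (contains? W) missing
    where
    missing : ¬ Contains F W → ⊥
    missing W∉F with sorting-permutation W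
    ... | σ , σ∈ , W-sorted =
      sum-values≮T m≡T σ∈ (sum-values<T σ∈ (<-≤-trans M<W (multinomial≤! n (shape W)))
                                           (⊓-glb (<-≤-trans count< count-ℓs≤t) count<))
      where
      v : ℕ
      v = M n (suc q) (suc t)
      count< : count (v <?_) (values σ) < count (v <?_) ℓs
      count< = missing-shape⇒count< σ∈ W W-sorted W∉F M<W
      count-ℓs≤t : count (v <?_) ℓs ≤ t
      count-ℓs≤t = lookupDefault≤⇒count≤ t ℓs-descending ≤-refl

lemma5p1 : (n r p : ℕ) → 1 ≤ r → 1 ≤ p →
    r ^ (p ∸ 1) ≤ (n + p ∸ 1) C (p ∸ 1) →
    (m : ℕ) (F : Fin m → WeakComposition n p) →
    Distinct F →
    (∀ (k : Fin p) → suc (toℕ k) < p → ChainFree r (λ j → part (F j) k)) →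
    m ≡ sumTopM n p (r ^ (p ∸ 1)) →
    ((W : WeakComposition n p) →
       multinomial n (shape W) > M n p (suc (r ^ (p ∸ 1))) → Contains F W)
    × (∀ (j : Fin m) → M n p (r ^ (p ∸ 1)) ≤ multinomial n (shape (F j)))
lemma5p1 n r (suc q) _ _ _ m F F-distinct F-chain-free m≡T = large-contained m≡T , members-large m≡T
  where open DoubleCounting F F-distinct F-chain-free
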